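{- In the game \textsc{saliquant}, for every positive integer $n$: if $3\mid n$, then $\mathcal{SG}(2n)\leq n-2$; and if $5\mid n$, then $\mathcal{SG}(4n)\leq 2n-3$.
   Context: \textsc{saliquant} is the normal-play impartial game whose positions are the positive integers, where the options of a position $n\geq 1$ are $\{n-k : 1\leq k\leq n,\ k\nmid n\}$. The nim-value is defined recursively by $\mathcal{SG}(n)=\operatorname{mex}\{\mathcal{SG}(x) : x \text{ an option of } n\}$, where $\operatorname{mex}(A)$ is the least nonnegative integer not in $A$. -}

module Defs where

open import Data.Nat using (ℕ; zero; suc; _∸_; _<?_; _≟_)
open import Data.Nat.Divisibility using (_∣?_)
open import Data.List using (List; []; _∷_; length; filter; map; upTo; applyUpTo)
open import Data.List.Membership.DecPropositional _≟_ using (_∈?_)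
open import Relation.Nullary using (yes; no; ¬?)

-- mex of a finite list of naturals: least natural not in the list.
-- Searching from `start` with enough fuel (length + 1 suffices).
mexFrom : ℕ → ℕ → List ℕ → ℕ
mexFrom zero    start A = start
mexFrom (suc f) start A with start ∈? A
... | yes _ = mexFrom f (suc start) A
... | no  _ = start

mex : List ℕ → ℕ
mex A = mexFrom (suc (length A)) 0 A

moves : ℕ → List ℕ
moves n = filter (λ k → ¬? (k ∣? n)) (applyUpTo suc n)

options : ℕ → List ℕ
options n = map (n ∸_) (moves n)

-- Given g correct on positions < n, compute the nim-value of n.
step : ℕ → (ℕ → ℕ) → ℕ
step n g = mex (map g (options n))

-- sgUpTo n m = SG(m) for m < n (value irrelevant for m ≥ n).
sgUpTo : ℕ → ℕ → ℕ
sgUpTo zero    m = 0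
sgUpTo (suc n) m with m <? n
... | yes _ = sgUpTo n m
... | no  _ = step n (sgUpTo n)

-- Sprague–Grundy value of position n in SALIQUANT:
-- SG(n) = mex { SG(x) : x an option of n }.
SG : ℕ → ℕ
SG n = sgUpTo (suc n) n

-- Every position satisfies 2 · SG(n) < n. So if an option n − k has value w, then
-- 2w + 1 ≤ n − k, i.e. k ≤ n − (2w + 1): SG(n) ≤ w as soon as none of these few
-- short moves reaches value w. For 2n with 3 ∣ n and w = n − 2 the short moves are
-- 1, 2, 3, all divisors of 2n. For 4n with 5 ∣ n and w = 2n − 3 they are 1, …, 5;
-- all but 3 divide 4n, and 4n − 3 is odd with SG(2j + 1) = j, so its value is 2n − 2.
module Submission where

open import Defs
open import Data.Nat using (ℕ; suc; _*_; _∸_; _≤_; _<_)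
open import Data.Nat.Divisibility using (_∣_)
open import Data.Product using (_×_)

open import Data.Nat using (zero; _+_; z≤n; s≤s; z<s; _<?_; _≤?_; _≟_; >-nonZero)
open import Data.Nat.Properties
open import Data.Nat.DivMod using (_/_; _%_; m≡m%n+[m/n]*n; m%n<n)
open import Data.Nat.Divisibility using (_∣?_; divides; ∣-refl; ∣-trans; ∣⇒≤; n∣m*n; m∣m*n; 1∣_)
open import Data.Nat.Induction using (<-rec)
open import Data.Nat.Tactic.RingSolver using (solve-∀)
open import Data.Product using (∃-syntax; _,_)
open import Data.List using (List; length; lookup; map; applyUpTo)
open import Data.List.Properties using (map-cong-local)
open import Data.List.Membership.Propositional using (_∈_; _∉_)
open import Data.List.Membership.Propositional.Properties
  using (∈-map⁻; ∈-map⁺; ∈-filter⁻; ∈-filter⁺; ∈-applyUpTo⁻; ∈-applyUpTo⁺)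
open import Data.List.Membership.DecPropositional _≟_ using (_∈?_)
open import Data.List.Relation.Unary.All using (tabulate)
open import Data.List.Relation.Unary.Any using (index)
open import Data.List.Relation.Unary.Any.Properties using (lookup-index)
open import Data.Fin using (toℕ)
open import Data.Fin.Properties using (pigeonhole; toℕ<n)
open import Relation.Nullary using (yes; no; ¬_; ¬?; contradiction)
open import Relation.Binary.PropositionalEquality

mexFrom-≤ : ∀ f s A {v} → s ≤ v → v ∉ A → mexFrom f s A ≤ v
mexFrom-≤ zero    s A s≤v v∉A = s≤v
mexFrom-≤ (suc f) s A s≤v v∉A with s ∈? A
... | yes s∈A = mexFrom-≤ f (suc s) A (≤∧≢⇒< s≤v λ { refl → v∉A s∈A }) v∉A
... | no  _   = s≤v

mex-≤ : ∀ A {v} → v ∉ A → mex A ≤ v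
mex-≤ A = mexFrom-≤ (suc (length A)) 0 A z≤n

-- Pigeonhole on the map sending i < v to its position in A.
range⊆⇒≤length : ∀ (A : List ℕ) {v} → (∀ {i} → i < v → i ∈ A) → v ≤ length A
range⊆⇒≤length A {v} range⊆A with v ≤? length A
... | yes v≤len = v≤len
... | no  v≰len with pigeonhole (≰⇒> v≰len) (λ i → index (range⊆A (toℕ<n i)))
...   | i , j , i<j , same-index = contradiction (begin
  toℕ i                                   ≡⟨ lookup-index (range⊆A (toℕ<n i)) ⟩
  lookup A (index (range⊆A (toℕ<n i)))    ≡⟨ cong (lookup A) same-index ⟩
  lookup A (index (range⊆A (toℕ<n j)))    ≡⟨ lookup-index (range⊆A (toℕ<n j)) ⟨
  toℕ j                                   ∎) (<⇒≢ i<j)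
  where open ≡-Reasoning

≤-mexFrom : ∀ f s A {v} → (∀ {i} → i < v → i ∈ A) → v ≤ s + f → v ≤ mexFrom f s A
≤-mexFrom zero    s A range⊆A v≤s+0 = subst (_ ≤_) (+-identityʳ s) v≤s+0
≤-mexFrom (suc f) s A {v} range⊆A v≤s+1+f with s ∈? A
... | yes _ = ≤-mexFrom f (suc s) A range⊆A (subst (v ≤_) (+-suc s f) v≤s+1+f)
... | no s∉A with v ≤? s
...   | yes v≤s = v≤s
...   | no  v≰s = contradiction (range⊆A (≰⇒> v≰s)) s∉A

≤-mex : ∀ A {v} → (∀ {i} → i < v → i ∈ A) → v ≤ mex A
≤-mex A range⊆A = ≤-mexFrom (suc (length A)) 0 A range⊆A (m≤n⇒m≤1+n (range⊆⇒≤length A range⊆A))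

Move : ℕ → ℕ → Set
Move n k = 1 ≤ k × k ≤ n × ¬ k ∣ n

move⇒< : ∀ {n k} → Move n k → k < n
move⇒< (_ , k≤n , k∤n) = ≤∧≢⇒< k≤n λ { refl → k∤n ∣-refl }

∈-options⁻ : ∀ {n y} → y ∈ options n → ∃[ k ] Move n k × y ≡ n ∸ k
∈-options⁻ {n} y∈ with ∈-map⁻ (n ∸_) y∈
... | k , k∈moves , refl with ∈-filter⁻ (λ k → ¬? (k ∣? n)) {xs = applyUpTo suc n} k∈moves
...   | k∈range , k∤n with ∈-applyUpTo⁻ suc k∈range
...     | _ , k≤n , refl = k , (s≤s z≤n , k≤n , k∤n) , refl

∈-options⁺ : ∀ {n k} → Move n k → n ∸ k ∈ options n
∈-options⁺ {n} {suc k} (_ , k≤n , k∤n) =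
  ∈-map⁺ (n ∸_) (∈-filter⁺ (λ k → ¬? (k ∣? n)) (∈-applyUpTo⁺ suc k≤n) k∤n)

options-< : ∀ {n y} → y ∈ options n → y < n
options-< {n} y∈ with ∈-options⁻ y∈
... | k , (1≤k , k≤n , _) , refl = ∸-monoʳ-< 1≤k k≤n

sgUpTo-top : ∀ n → sgUpTo (suc n) n ≡ step n (sgUpTo n)
sgUpTo-top n with n <? n
... | yes n<n = contradiction n<n (<-irrefl refl)
... | no  _   = refl

sgUpTo-stable : ∀ {n m} → m < n → sgUpTo n m ≡ SG m
sgUpTo-stable {suc n} {m} m<1+n with m <? n
... | yes m<n = sgUpTo-stable m<n
... | no  m≮n with ≤-antisym (≤-pred m<1+n) (≮⇒≥ m≮n)
...   | refl = sym (sgUpTo-top m)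

SG-unfold : ∀ n → SG n ≡ mex (map SG (options n))
SG-unfold n = trans (sgUpTo-top n)
  (cong mex (map-cong-local {xs = options n} (tabulate (λ y∈ → sgUpTo-stable (options-< y∈)))))

SG-≤ : ∀ n {v} → (∀ {k} → Move n k → SG (n ∸ k) ≢ v) → SG n ≤ v
SG-≤ n {v} unreachable = subst (_≤ v) (sym (SG-unfold n)) (mex-≤ _ v∉)
  where
  v∉ : v ∉ map SG (options n)
  v∉ v∈ with ∈-map⁻ SG v∈
  ... | y , y∈ , v≡SGy with ∈-options⁻ y∈
  ...   | k , move , refl = unreachable move (sym v≡SGy)

≤-SG : ∀ n {v} → (∀ {i} → i < v → ∃[ k ] Move n k × SG (n ∸ k) ≡ i) → v ≤ SG n
≤-SG n {v} reachable = subst (v ≤_) (sym (SG-unfold n)) (≤-mex _ i∈)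
  where
  i∈ : ∀ {i} → i < v → i ∈ map SG (options n)
  i∈ i<v with reachable i<v
  ... | k , move , refl = ∈-map⁺ SG (∈-options⁺ move)

SG-≤-by-short-moves : ∀ n w c → n ≡ 1 + 2 * w + c →
  (∀ {y} → y < n → 0 < y → 2 * SG y < y) →
  (∀ {k} → Move n k → k ≤ c → SG (n ∸ k) ≢ w) → SG n ≤ w
SG-≤-by-short-moves n w c refl bound short = SG-≤ n unreachable
  where
  unreachable : ∀ {k} → Move n k → SG (n ∸ k) ≢ w
  unreachable {k} move@(1≤k , k≤n , _) SG≡w = short move k≤c SG≡w
    where
    2w<n∸k : 1 + 2 * w ≤ n ∸ k
    2w<n∸k = subst (λ v → 2 * v < n ∸ k) SG≡w
      (bound (∸-monoʳ-< 1≤k k≤n) (m<n⇒0<n∸m (move⇒< move)))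
    k≤c : k ≤ c
    k≤c = ∸-cancelʳ-≤ k≤n (subst (_≤ n ∸ k) (sym (m+n∸n≡m (1 + 2 * w) c)) 2w<n∸k)

-- Write n = 1 + 2w + c with c ≤ 1: the only move of length ≤ c is 1, a divisor of n.
2*SG[n]<n : ∀ n → 0 < n → 2 * SG n < n
2*SG[n]<n = <-rec (λ n → 0 < n → 2 * SG n < n) induction-step
  where
  induction-step : ∀ n → (∀ {y} → y < n → 0 < y → 2 * SG y < y) → 0 < n → 2 * SG n < n
  induction-step (suc m) bound _ = begin-strict
    2 * SG (suc m)     <⟨ s≤s (*-monoʳ-≤ 2 SG≤w) ⟩
    1 + 2 * w          ≤⟨ m≤m+n (1 + 2 * w) c ⟩
    1 + 2 * w + c      ≡⟨ n≡1+2w+c ⟨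
    suc m              ∎
    where
    open ≤-Reasoning
    w = m / 2
    c = m % 2
    n≡1+2w+c : suc m ≡ 1 + 2 * w + c
    n≡1+2w+c = trans (cong suc (m≡m%n+[m/n]*n m 2)) (identity c w)
      where
      identity : ∀ c w → suc (c + w * 2) ≡ 1 + 2 * w + c
      identity = solve-∀
    only-move-1 : ∀ {k} → Move (suc m) k → k ≤ c → SG (suc m ∸ k) ≢ w
    only-move-1 {k} (1≤k , _ , k∤n) k≤c = contradiction (subst (_∣ suc m) k≡1 (1∣ suc m)) k∤n
      where
      k≡1 : 1 ≡ k
      k≡1 = ≤-antisym 1≤k (≤-trans k≤c (≤-pred (m%n<n m 2)))
    SG≤w : SG (suc m) ≤ w
    SG≤w = SG-≤-by-short-moves (suc m) w c n≡1+2w+c bound only-move-1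

2∤1+2*n : ∀ n → ¬ 2 ∣ 1 + 2 * n
2∤1+2*n n (divides q 1+2n≡q*2) = even≢odd q n (sym (trans 1+2n≡q*2 (*-comm q 2)))

-- From 2j + 1, the move 2(j − i) is even, hence not a divisor, and reaches 2i + 1.
SG-odd : ∀ j → SG (1 + 2 * j) ≡ j
SG-odd = <-rec (λ j → SG (1 + 2 * j) ≡ j) induction-step
  where
  induction-step : ∀ j → (∀ {i} → i < j → SG (1 + 2 * i) ≡ i) → SG (1 + 2 * j) ≡ j
  induction-step j SG-odd-below = ≤-antisym SG≤j j≤SG
    where
    SG≤j : SG (1 + 2 * j) ≤ j
    SG≤j = *-cancelˡ-≤ 2 (≤-pred (2*SG[n]<n (1 + 2 * j) z<s))
    move-to : ∀ {i} → i < j → ∃[ k ] Move (1 + 2 * j) k × SG (1 + 2 * j ∸ k) ≡ i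
    move-to {i} i<j with m≤n⇒∃[o]m+o≡n i<j
    ... | o , refl = k , (s≤s z≤n , k≤1+2j , k∤1+2j) , trans (cong SG lands) (SG-odd-below i<j)
      where
      k = 2 * suc o
      split : 1 + 2 * j ≡ 1 + 2 * i + k
      split = identity i o
        where
        identity : ∀ i o → 1 + 2 * (suc i + o) ≡ 1 + 2 * i + 2 * suc o
        identity = solve-∀
      k≤1+2j : k ≤ 1 + 2 * j
      k≤1+2j = subst (k ≤_) (sym split) (m≤n+m k (1 + 2 * i))
      k∤1+2j : ¬ k ∣ 1 + 2 * j
      k∤1+2j k∣ = 2∤1+2*n j (∣-trans (m∣m*n (suc o)) k∣)
      lands : 1 + 2 * j ∸ k ≡ 1 + 2 * i
      lands = trans (cong (_∸ k) split) (m+n∸n≡m (1 + 2 * i) k)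
    j≤SG : j ≤ SG (1 + 2 * j)
    j≤SG = ≤-SG (1 + 2 * j) move-to

SG[2n]≤n∸2 : ∀ n → 0 < n → 3 ∣ n → SG (2 * n) ≤ n ∸ 2
SG[2n]≤n∸2 n 0<n 3∣n with m≤n⇒∃[o]m+o≡n (∣⇒≤ {{>-nonZero 0<n}} 3∣n)
SG[2n]≤n∸2 .(3 + m) _ 3∣n | m , refl =
  SG-≤-by-short-moves (2 * n) (1 + m) 3 (split m) (λ _ → 2*SG[n]<n _) short
  where
  n = 3 + m
  split : ∀ m → 2 * (3 + m) ≡ 1 + 2 * (1 + m) + 3
  split = solve-∀
  ∣2n : ∀ k → 1 ≤ k → k ≤ 3 → k ∣ 2 * n
  ∣2n 1 _ _ = 1∣ _
  ∣2n 2 _ _ = m∣m*n n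
  ∣2n 3 _ _ = ∣-trans 3∣n (n∣m*n 2)
  ∣2n (suc (suc (suc (suc _)))) _ (s≤s (s≤s (s≤s ())))
  short : ∀ {k} → Move (2 * n) k → k ≤ 3 → SG (2 * n ∸ k) ≢ 1 + m
  short {k} (1≤k , _ , k∤2n) k≤3 _ = k∤2n (∣2n k 1≤k k≤3)

SG[4n]≤2n∸3 : ∀ n → 0 < n → 5 ∣ n → SG (4 * n) ≤ 2 * n ∸ 3
SG[4n]≤2n∸3 n 0<n 5∣n with m≤n⇒∃[o]m+o≡n (∣⇒≤ {{>-nonZero 0<n}} 5∣n)
SG[4n]≤2n∸3 .(5 + m) _ 5∣n | m , refl =
  subst (SG (4 * n) ≤_) (sym 2n∸3≡w)
    (SG-≤-by-short-moves (4 * n) w 5 (split m) (λ _ → 2*SG[n]<n _) short)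
  where
  n = 5 + m
  w = 7 + 2 * m
  split : ∀ m → 4 * (5 + m) ≡ 1 + 2 * (7 + 2 * m) + 5
  split = solve-∀
  2n∸3≡w : 2 * n ∸ 3 ≡ w
  2n∸3≡w = trans (cong (_∸ 3) (identity m)) (m+n∸m≡n 3 w)
    where
    identity : ∀ m → 2 * (5 + m) ≡ 3 + (7 + 2 * m)
    identity = solve-∀
  4n∸3≡1+2[1+w] : 4 * n ∸ 3 ≡ 1 + 2 * (1 + w)
  4n∸3≡1+2[1+w] = trans (cong (_∸ 3) (identity m)) (m+n∸m≡n 3 (1 + 2 * (1 + w)))
    where
    identity : ∀ m → 4 * (5 + m) ≡ 3 + (1 + 2 * (1 + (7 + 2 * m)))
    identity = solve-∀
  ∣4n : ∀ k → 1 ≤ k → k ≤ 5 → k ≢ 3 → k ∣ 4 * n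
  ∣4n 1 _ _ _ = 1∣ _
  ∣4n 2 _ _ _ = ∣-trans (divides 2 refl) (m∣m*n n)
  ∣4n 3 _ _ k≢3 = contradiction refl k≢3
  ∣4n 4 _ _ _ = m∣m*n n
  ∣4n 5 _ _ _ = ∣-trans 5∣n (n∣m*n 4)
  ∣4n (suc (suc (suc (suc (suc (suc _)))))) _ (s≤s (s≤s (s≤s (s≤s (s≤s ()))))) _
  short : ∀ {k} → Move (4 * n) k → k ≤ 5 → SG (4 * n ∸ k) ≢ w
  short {k} (1≤k , _ , k∤4n) k≤5 with k ≟ 3
  ... | yes refl = λ SG≡w → 1+n≢n (trans (sym SG-4n∸3) SG≡w)
    where
    SG-4n∸3 : SG (4 * n ∸ 3) ≡ 1 + w
    SG-4n∸3 = trans (cong SG 4n∸3≡1+2[1+w]) (SG-odd (1 + w))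
  ... | no  k≢3 = λ _ → k∤4n (∣4n k 1≤k k≤5 k≢3)

mainTheorem5 : (n : ℕ) → 0 < n →
    (3 ∣ n → SG (2 * n) ≤ n ∸ 2) × (5 ∣ n → SG (4 * n) ≤ 2 * n ∸ 3)
mainTheorem5 n 0<n = SG[2n]≤n∸2 n 0<n , SG[4n]≤2n∸3 n 0<n
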